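{- Let $r, m \in \mathbb{N}$ and let $G$ be an $r$-uniform hypergraph. Then there is a vertex set $Y$ of size at most $C(r,m)$, where $C(r,m)$ depends only on $r$ and $m$, such that the following holds. For any $X\subseteq Y$ such that $G_{Y}(X)$ is nonempty, letting $d$ be the maximum integer such that $G_{Y}^{(d)}(X)$ is nonempty, the hypergraph $G_{Y}^{(d)}(X)$ has a matching of size at least $m$. Moreover, if $Y\neq \emptyset$, then every edge of $G$ has nonempty intersection with $Y$.
   Context: For an $r$-uniform hypergraph $G$ and vertex subsets $X\subseteq Y$, $G_{Y}(X)=\{e\setminus X: e\in E(G),\ e\cap (Y\setminus X)=\emptyset,\ e\setminus X\ne\emptyset\}$; that is, delete all edges meeting $Y\setminus X$ and take the part of each remaining edge outside $X$. This is a hypergraph with edge sizes between $1$ and $r$; for $d\in[r]$, $G^{(d)}_Y(X)$ is the subhypergraph of its edges of size exactly $d$. A matching is a collection of pairwise vertex-disjoint edges. -}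

module Defs where

open import Data.Nat using (ℕ; _≤_)
open import Data.List using (List; length)
open import Data.Product using (Σ; _×_; ∃)
open import Data.Fin.Subset using (Subset; _∩_; _─_; ⊥; ∣_∣; Nonempty; _⊆_)
open import Data.List.Relation.Unary.All using (All)
open import Data.List.Relation.Unary.AllPairs using (AllPairs)
import Data.List.Membership.Propositional as L
open import Relation.Binary.PropositionalEquality using (_≡_)

Hypergraph : ℕ → Set
Hypergraph n = List (Subset n)

_∈E_ : ∀ {n} → Subset n → Hypergraph n → Set
e ∈E G = e L.∈ G

Uniform : ∀ {n} → ℕ → Hypergraph n → Set
Uniform r G = All (λ e → ∣ e ∣ ≡ r) G

EdgeOf-GYX : ∀ {n} → Hypergraph n → (Y X : Subset n) → Subset n → Set
EdgeOf-GYX {n} G Y X f =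
  Σ (Subset n) λ e → e ∈E G × (e ∩ (Y ─ X) ≡ ⊥) × (f ≡ e ─ X) × Nonempty f

EdgeOf-GYXd : ∀ {n} → Hypergraph n → (Y X : Subset n) → ℕ → Subset n → Set
EdgeOf-GYXd G Y X d f = EdgeOf-GYX G Y X f × ∣ f ∣ ≡ d

GYX-Nonempty : ∀ {n} → Hypergraph n → (Y X : Subset n) → Set
GYX-Nonempty {n} G Y X = Σ (Subset n) λ f → EdgeOf-GYX G Y X f

IsMaxEdgeSize : ∀ {n} → Hypergraph n → (Y X : Subset n) → ℕ → Set
IsMaxEdgeSize {n} G Y X d =
  (Σ (Subset n) λ f → EdgeOf-GYXd G Y X d f)
  × (∀ d' → Σ (Subset n) (λ f → EdgeOf-GYXd G Y X d' f) → d' ≤ d)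

HasMatchingOfSize : ∀ {n} → (Subset n → Set) → ℕ → Set
HasMatchingOfSize {n} P m =
  Σ (List (Subset n)) λ M →
    (m ≤ length M) × All P M × AllPairs (λ a b → a ∩ b ≡ ⊥) M

module Submission where

open import Defs
open import Data.Nat using (ℕ; _≤_)
open import Data.Product using (Σ; _×_)
open import Data.Fin.Subset using (Subset; _⊆_; _∩_; ∣_∣; Nonempty)

open import Data.Bool using (true; false)
import Data.Bool.Properties as Bool
open import Data.Empty using (⊥-elim)
open import Data.Fin.Subset using (_∪_; _─_; ⊥; ⋃; _∈_; _∉_)
open import Data.Fin.Subset.Properties
open import Data.List using (List; []; _∷_; length; map; filter; concatMap; _++_)
open import Data.List.Properties using (length-map; length-++; length-filter; filter-notAll)
open import Data.List.Membership.Propositional using () renaming (_∈_ to _∈ₗ_)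
open import Data.List.Membership.Propositional.Properties
  using (∈-map⁺; ∈-map⁻; ∈-filter⁺; ∈-filter⁻; ∈-++⁺ˡ; ∈-++⁺ʳ)
open import Data.List.Relation.Unary.All as All using (All; []; _∷_; all?)
import Data.List.Relation.Unary.All.Properties as All
open import Data.List.Relation.Unary.AllPairs using (AllPairs; []; _∷_)
open import Data.List.Relation.Unary.Any using (here; there)
open import Data.Nat using (zero; suc; _+_; _*_; _∸_; _^_; _<_; z≤n; s≤s; _<?_; _≤?_)
open import Data.Nat.Properties
open import Data.Product using (_,_; proj₁; proj₂; ∃)
open import Data.Sum using (_⊎_; inj₁; inj₂; [_,_])
open import Data.Vec using ([]; _∷_; here; there)
open import Data.Vec.Properties using (≡-dec)
open import Function using (_∘_)
open import Relation.Binary.Definitions using (DecidableEquality)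
open import Relation.Binary.PropositionalEquality
  using (_≡_; refl; sym; trans; cong; cong₂; subst; module ≡-Reasoning)
open import Relation.Nullary using (¬_; Dec; yes; no; ¬?)
open import Relation.Nullary.Decidable using (decidable-stable)

-- Call Y m-good for G if it satisfies the matching condition of the theorem.
-- If G has a matching of size m + |Y|, then Y is m-good: at most |Y| of the
-- matching edges meet Y, and the others survive intact in every G_Y(X) as
-- edges of the largest possible size r.  Otherwise the vertex set V of a
-- maximal (greedy) matching has fewer than m r elements and meets every edge,
-- and Y = V ∪ Z is m-good for G as soon as Z is m-good for every link
-- G_T = {e ∖ V : e ∩ V = T}, T ⊆ V.  The 2^|V| links have uniformity < r, so
-- by induction on the uniformity it suffices to find one bounded good set for
-- a bounded family of hypergraphs.  For a family, pigeonhole on the sizes of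
-- the greedy matchings gives a threshold t such that each member has a
-- matching either smaller than t (so it is covered by < t r vertices) or larger
-- than m plus the final size of Y; the former are handled through their links
-- and the latter are good for any such Y.

Disjoint : ∀ {n} → Subset n → Subset n → Set
Disjoint p q = p ∩ q ≡ ⊥

x∈p─q⇒x∉q : ∀ {n} (p q : Subset n) {x} → x ∈ p ─ q → x ∉ q
x∈p─q⇒x∉q (true ∷ p) (false ∷ q) here ()
x∈p─q⇒x∉q (_ ∷ p) (_ ∷ q) (there x∈p─q) (there x∈q) = x∈p─q⇒x∉q p q x∈p─q x∈q

x∈p─q⁻ : ∀ {n} {p q : Subset n} {x} → x ∈ p ─ q → x ∈ p × x ∉ q
x∈p─q⁻ {p = p} {q} x∈ = p─q⊆p p q x∈ , x∈p─q⇒x∉q p q x∈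

disjoint⁺ : ∀ {n} {p q : Subset n} → (∀ {x} → x ∈ p → x ∉ q) → Disjoint p q
disjoint⁺ {p = p} {q} h = Empty-unique λ (x , x∈) → let (x∈p , x∈q) = x∈p∩q⁻ p q x∈ in h x∈p x∈q

disjoint⁻ : ∀ {n} {p q : Subset n} {x} → Disjoint p q → x ∈ p → x ∉ q
disjoint⁻ {x = x} p∩q≡⊥ x∈p x∈q = ∉⊥ (subst (x ∈_) p∩q≡⊥ (x∈p∩q⁺ (x∈p , x∈q)))

disjoint-⊆ʳ : ∀ {n} {p q r : Subset n} → r ⊆ q → Disjoint p q → Disjoint p r
disjoint-⊆ʳ r⊆q pq = disjoint⁺ λ x∈p x∈r → disjoint⁻ pq x∈p (r⊆q x∈r)

disjoint-─ : ∀ {n} {e a y : Subset n} → Disjoint e a → Disjoint a (y ─ e) → Disjoint a y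
disjoint-─ {e = e} {a} {y} ea ay─e = disjoint⁺ a∉y
  where
  a∉y : ∀ {x} → x ∈ a → x ∉ y
  a∉y {x} x∈a x∈y with x ∈? e
  ... | yes x∈e = disjoint⁻ ea x∈e x∈a
  ... | no x∉e = disjoint⁻ ay─e x∈a (x∈p∧x∉q⇒x∈p─q x∈y x∉e)

p─q≡p : ∀ {n} {p q : Subset n} → Disjoint p q → p ─ q ≡ p
p─q≡p {p = p} {q} pq = ⊆-antisym (p─q⊆p p q) λ x∈p → x∈p∧x∉q⇒x∈p─q x∈p (disjoint⁻ pq x∈p)

⊆⋃ : ∀ {n} {a : Subset n} {M} → a ∈ₗ M → a ⊆ ⋃ M
⊆⋃ {M = _ ∷ M} (here refl) = p⊆p∪q (⋃ M)
⊆⋃ {M = b ∷ M} (there a∈M) = q⊆p∪q b (⋃ M) ∘ ⊆⋃ a∈M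

∣p∣≡∣p∩q∣+∣p─q∣ : ∀ {n} (p q : Subset n) → ∣ p ∣ ≡ ∣ p ∩ q ∣ + ∣ p ─ q ∣
∣p∣≡∣p∩q∣+∣p─q∣ [] [] = refl
∣p∣≡∣p∩q∣+∣p─q∣ (true ∷ p) (true ∷ q) = cong suc (∣p∣≡∣p∩q∣+∣p─q∣ p q)
∣p∣≡∣p∩q∣+∣p─q∣ (true ∷ p) (false ∷ q) = trans (cong suc (∣p∣≡∣p∩q∣+∣p─q∣ p q)) (sym (+-suc _ _))
∣p∣≡∣p∩q∣+∣p─q∣ (false ∷ p) (true ∷ q) = ∣p∣≡∣p∩q∣+∣p─q∣ p q
∣p∣≡∣p∩q∣+∣p─q∣ (false ∷ p) (false ∷ q) = ∣p∣≡∣p∩q∣+∣p─q∣ p q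

∣p∪q∣≤∣p∣+∣q∣ : ∀ {n} (p q : Subset n) → ∣ p ∪ q ∣ ≤ ∣ p ∣ + ∣ q ∣
∣p∪q∣≤∣p∣+∣q∣ [] [] = z≤n
∣p∪q∣≤∣p∣+∣q∣ (true ∷ p) (true ∷ q) = s≤s (≤-trans (∣p∪q∣≤∣p∣+∣q∣ p q) (+-monoʳ-≤ ∣ p ∣ (n≤1+n _)))
∣p∪q∣≤∣p∣+∣q∣ (true ∷ p) (false ∷ q) = s≤s (∣p∪q∣≤∣p∣+∣q∣ p q)
∣p∪q∣≤∣p∣+∣q∣ (false ∷ p) (true ∷ q) = subst (suc ∣ p ∪ q ∣ ≤_) (sym (+-suc ∣ p ∣ ∣ q ∣)) (s≤s (∣p∪q∣≤∣p∣+∣q∣ p q))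
∣p∪q∣≤∣p∣+∣q∣ (false ∷ p) (false ∷ q) = ∣p∪q∣≤∣p∣+∣q∣ p q

∣⋃M∣≤ : ∀ {n} c (M : List (Subset n)) → All (λ a → ∣ a ∣ ≤ c) M → ∣ ⋃ M ∣ ≤ length M * c
∣⋃M∣≤ {n} c [] [] = ≤-reflexive (∣⊥∣≡0 n)
∣⋃M∣≤ c (a ∷ M) (a≤c ∷ M≤c) = ≤-trans (∣p∪q∣≤∣p∣+∣q∣ a (⋃ M)) (+-mono-≤ a≤c (∣⋃M∣≤ c M M≤c))

nonempty⇒∣p∣>0 : ∀ {n} {p : Subset n} → Nonempty p → 0 < ∣ p ∣
nonempty⇒∣p∣>0 {p = p} (x , x∈p) =
  subst (_≤ ∣ p ∣) (∣⁅x⁆∣≡1 x) (p⊆q⇒∣p∣≤∣q∣ λ y∈⁅x⁆ → subst (_∈ p) (sym (x∈⁅y⁆⇒x≡y x y∈⁅x⁆)) x∈p)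

∣p∣>0⇒nonempty : ∀ {n} {p : Subset n} → 0 < ∣ p ∣ → Nonempty p
∣p∣>0⇒nonempty {n} {p} ∣p∣>0 with nonempty? p
... | yes ne = ne
... | no empty = ⊥-elim (<-irrefl (sym (trans (cong ∣_∣ (Empty-unique empty)) (∣⊥∣≡0 n))) ∣p∣>0)

Good : ∀ {n} → ℕ → Subset n → Hypergraph n → Set
Good {n} m Y G = ∀ (X : Subset n) → X ⊆ Y → GYX-Nonempty G Y X →
  ∀ (d : ℕ) → IsMaxEdgeSize G Y X d → HasMatchingOfSize (EdgeOf-GYXd G Y X d) m

module _ {n} {ℓ} {G : Hypergraph n} (uniform : Uniform ℓ G) where

  ∣edge∣≤rank : ∀ {Y X f : Subset n} → EdgeOf-GYX G Y X f → ∣ f ∣ ≤ ℓ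
  ∣edge∣≤rank {X = X} (e , e∈G , _ , refl , _) =
    subst (∣ e ─ X ∣ ≤_) (All.lookup uniform e∈G) (∣p─q∣≤∣p∣ e X)

  rank>0 : ∀ {Y X : Subset n} → GYX-Nonempty G Y X → 0 < ℓ
  rank>0 (_ , edge@(_ , _ , _ , _ , f≢∅)) = ≤-trans (nonempty⇒∣p∣>0 f≢∅) (∣edge∣≤rank edge)

  intactEdge : ∀ {Y X a : Subset n} → 0 < ℓ → X ⊆ Y → a ∈E G → Disjoint a Y → EdgeOf-GYXd G Y X ℓ a
  intactEdge {Y} {X} {a} ℓ>0 X⊆Y a∈G aY =
    (a , a∈G , disjoint-⊆ʳ (p─q⊆p Y X) aY , sym (p─q≡p (disjoint-⊆ʳ X⊆Y aY)) ,
     ∣p∣>0⇒nonempty (subst (0 <_) (sym ∣a∣≡ℓ) ℓ>0)) , ∣a∣≡ℓ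
    where
    ∣a∣≡ℓ : ∣ a ∣ ≡ ℓ
    ∣a∣≡ℓ = All.lookup uniform a∈G

good-of-0-uniform : ∀ {n} m (Y : Subset n) {G} → Uniform 0 G → Good m Y G
good-of-0-uniform m Y uniform X _ nonempty = ⊥-elim (<-irrefl refl (rank>0 uniform nonempty))

avoiding : ∀ {n} {P : Subset n → Set} (Y : Subset n) (M : List (Subset n)) → All P M → AllPairs Disjoint M →
  Σ (List (Subset n)) λ A → length M ≤ length A + ∣ Y ∣ × All (λ a → P a × Disjoint a Y) A × AllPairs Disjoint A
avoiding Y [] [] [] = [] , z≤n , [] , []
avoiding Y (e ∷ M) (Pe ∷ PM) (e-M ∷ disjM) with nonempty? (Y ∩ e)
... | no Y∩e≡∅ =
  let (A , M≤ , PA , disjA) = avoiding Y M (All.zip (PM , e-M)) disjM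
  in e ∷ A , s≤s M≤ , (Pe , trans (∩-comm e Y) (Empty-unique Y∩e≡∅)) ∷ All.map (λ ((Pa , _) , aY) → Pa , aY) PA ,
     All.map (λ ((_ , ea) , _) → ea) PA ∷ disjA
... | yes Y∩e≢∅ =
  let (A , M≤ , PA , disjA) = avoiding (Y ─ e) M (All.zip (PM , e-M)) disjM
  in A ,
     ≤-trans (s≤s M≤) (≤-trans (≤-reflexive (sym (+-suc _ _)))
                               (+-monoʳ-≤ (length A) (p∩q≢∅⇒∣p─q∣<∣p∣ Y e Y∩e≢∅))) ,
     All.map (λ ((Pa , ea) , aY─e) → Pa , disjoint-─ ea aY─e) PA , disjA

good-of-large-matching : ∀ {n} {ℓ} {G : Hypergraph n} m (Y : Subset n) → Uniform ℓ G →
  (M : List (Subset n)) → All (_∈E G) M → AllPairs Disjoint M → m + ∣ Y ∣ ≤ length M → Good m Y G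
good-of-large-matching {ℓ = ℓ} {G} m Y uniform M M⊆G disjM m+∣Y∣≤∣M∣ X X⊆Y nonempty d
  ((f , edge , ∣f∣≡d) , maximal) with avoiding Y M M⊆G disjM
... | A , M≤ , avoidY , disjA =
  A , +-cancelʳ-≤ ∣ Y ∣ m (length A) (≤-trans m+∣Y∣≤∣M∣ M≤) , All.map maximumEdge avoidY , disjA
  where
  d≤ℓ : d ≤ ℓ
  d≤ℓ = subst (_≤ ℓ) ∣f∣≡d (∣edge∣≤rank uniform edge)
  maximumEdge : ∀ {a} → a ∈E G × Disjoint a Y → EdgeOf-GYXd G Y X d a
  maximumEdge {a} (a∈G , aY) with intactEdge uniform (rank>0 uniform nonempty) X⊆Y a∈G aY
  ... | edge′ , ∣a∣≡ℓ = edge′ , trans ∣a∣≡ℓ (≤-antisym (maximal _ (a , edge′ , ∣a∣≡ℓ)) d≤ℓ)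

Covers : ∀ {n} → Subset n → Hypergraph n → Set
Covers V G = ∀ {e} → e ∈E G → Nonempty e → Nonempty (e ∩ V)

covers-⊆ : ∀ {n} {V W : Subset n} {G} → V ⊆ W → Covers V G → Covers W G
covers-⊆ V⊆W covers e∈G ne = let (x , x∈e∩V) = covers e∈G ne ; (x∈e , x∈V) = x∈p∩q⁻ _ _ x∈e∩V
  in x , x∈p∩q⁺ (x∈e , V⊆W x∈V)

extend : ∀ {n} → Subset n → List (Subset n) → List (Subset n)
extend e M with nonempty? (e ∩ ⋃ M)
... | yes _ = M
... | no _ = e ∷ M

greedy : ∀ {n} → Hypergraph n → List (Subset n)
greedy [] = []
greedy (e ∷ G) = extend e (greedy G)

module _ {n} (e : Subset n) (M : List (Subset n)) where

  extend⁺ : ∀ {P : Subset n → Set} → P e → All P M → All P (extend e M)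
  extend⁺ Pe PM with nonempty? (e ∩ ⋃ M)
  ... | yes _ = PM
  ... | no _ = Pe ∷ PM

  extend-disjoint : AllPairs Disjoint M → AllPairs Disjoint (extend e M)
  extend-disjoint disjM with nonempty? (e ∩ ⋃ M)
  ... | yes _ = disjM
  ... | no e∩⋃M≡∅ = All.tabulate (λ a∈M → disjoint-⊆ʳ (⊆⋃ a∈M) (Empty-unique e∩⋃M≡∅)) ∷ disjM

  ⋃⊆⋃extend : ⋃ M ⊆ ⋃ (extend e M)
  ⋃⊆⋃extend with nonempty? (e ∩ ⋃ M)
  ... | yes _ = λ x∈ → x∈
  ... | no _ = q⊆p∪q e (⋃ M)

  extend-meets : Nonempty e → Nonempty (e ∩ ⋃ (extend e M))
  extend-meets (x , x∈e) with nonempty? (e ∩ ⋃ M)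
  ... | yes e∩⋃M≢∅ = e∩⋃M≢∅
  ... | no _ = x , x∈p∩q⁺ (x∈e , p⊆p∪q (⋃ M) x∈e)

greedy⊆ : ∀ {n} (G : Hypergraph n) → All (_∈E G) (greedy G)
greedy⊆ [] = []
greedy⊆ (e ∷ G) = extend⁺ e (greedy G) (here refl) (All.map there (greedy⊆ G))

greedy-disjoint : ∀ {n} (G : Hypergraph n) → AllPairs Disjoint (greedy G)
greedy-disjoint [] = []
greedy-disjoint (e ∷ G) = extend-disjoint e (greedy G) (greedy-disjoint G)

greedy-covers : ∀ {n} (G : Hypergraph n) → Covers (⋃ (greedy G)) G
greedy-covers (e ∷ G) (here refl) ne = extend-meets e (greedy G) ne
greedy-covers (e ∷ G) (there e′∈G) ne = covers-⊆ (⋃⊆⋃extend e (greedy G)) (greedy-covers G) e′∈G ne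

∣⋃greedy∣≤ : ∀ {n} {ℓ} (G : Hypergraph n) → Uniform ℓ G → ∣ ⋃ (greedy G) ∣ ≤ length (greedy G) * ℓ
∣⋃greedy∣≤ {ℓ = ℓ} G uniform = ∣⋃M∣≤ ℓ (greedy G) (All.map (≤-reflexive ∘ All.lookup uniform) (greedy⊆ G))

module _ {n} {V Z X : Subset n} where

  trace⊆ : ∀ {e} → Disjoint e ((V ∪ Z) ─ X) → e ∩ V ⊆ X
  trace⊆ {e} eY x∈e∩V with x∈p∩q⁻ e V x∈e∩V
  ... | x∈e , x∈V = decidable-stable (_ ∈? X) λ x∉X →
    disjoint⁻ eY x∈e (x∈p∧x∉q⇒x∈p─q (p⊆p∪q Z x∈V) x∉X)

  survives-link : ∀ {e} → Disjoint e ((V ∪ Z) ─ X) → Disjoint (e ─ V) (Z ─ X ∩ Z)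
  survives-link eY = disjoint⁺ λ x∈e─V x∈Z─X∩Z →
    let (x∈e , _) = x∈p─q⁻ x∈e─V ; (x∈Z , x∉X∩Z) = x∈p─q⁻ x∈Z─X∩Z
    in disjoint⁻ eY x∈e (x∈p∧x∉q⇒x∈p─q (q⊆p∪q V Z x∈Z) λ x∈X → x∉X∩Z (x∈p∩q⁺ (x∈X , x∈Z)))

  module _ {e} (T⊆X : e ∩ V ⊆ X) where

    private
      x∉V : ∀ {x} → x ∈ e → x ∉ X → x ∉ V
      x∉V x∈e x∉X x∈V = x∉X (T⊆X (x∈p∩q⁺ (x∈e , x∈V)))

    survives-from-link : Disjoint (e ─ V) (Z ─ X ∩ Z) → Disjoint e ((V ∪ Z) ─ X)
    survives-from-link e─V∩Z─X≡∅ = disjoint⁺ λ x∈e x∈Y─X →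
      let (x∈V∪Z , x∉X) = x∈p─q⁻ x∈Y─X ; x∉V′ = x∉V x∈e x∉X
      in [ x∉V′ , (λ x∈Z → disjoint⁻ e─V∩Z─X≡∅ (x∈p∧x∉q⇒x∈p─q x∈e x∉V′)
                              (x∈p∧x∉q⇒x∈p─q x∈Z (x∉X ∘ proj₁ ∘ x∈p∩q⁻ X Z))) ]
           (x∈p∪q⁻ V Z x∈V∪Z)

    restrict-link : X ⊆ V ∪ Z → e ─ X ≡ (e ─ V) ─ X ∩ Z
    restrict-link X⊆Y = ⊆-antisym
      (λ x∈e─X → let (x∈e , x∉X) = x∈p─q⁻ x∈e─X in
        x∈p∧x∉q⇒x∈p─q (x∈p∧x∉q⇒x∈p─q x∈e (x∉V x∈e x∉X)) (x∉X ∘ proj₁ ∘ x∈p∩q⁻ X Z))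
      λ x∈ → let (x∈e─V , x∉X∩Z) = x∈p─q⁻ x∈ ; (x∈e , x∉V′) = x∈p─q⁻ x∈e─V in
        x∈p∧x∉q⇒x∈p─q x∈e λ x∈X →
          [ x∉V′ , (λ x∈Z → x∉X∩Z (x∈p∩q⁺ (x∈X , x∈Z))) ] (x∈p∪q⁻ V Z (X⊆Y x∈X))

infix 4 _≟ₛ_
_≟ₛ_ : ∀ {n} → DecidableEquality (Subset n)
_≟ₛ_ = ≡-dec Bool._≟_

link : ∀ {n} → Hypergraph n → Subset n → Subset n → Hypergraph n
link G V T = map (_─ V) (filter (λ e → e ∩ V ≟ₛ T) G)

link-∈⁺ : ∀ {n} {G : Hypergraph n} V {e} → e ∈E G → (e ─ V) ∈E link G V (e ∩ V)
link-∈⁺ V {e} e∈G = ∈-map⁺ (_─ V) (∈-filter⁺ (λ e′ → e′ ∩ V ≟ₛ e ∩ V) e∈G refl)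

link-∈⁻ : ∀ {n} {G : Hypergraph n} V T {a} → a ∈E link G V T →
  Σ (Subset n) λ e → e ∈E G × e ∩ V ≡ T × a ≡ e ─ V
link-∈⁻ V T a∈link with ∈-map⁻ (_─ V) a∈link
... | e , e∈filter , refl with ∈-filter⁻ (λ e′ → e′ ∩ V ≟ₛ T) e∈filter
... | e∈G , e∩V≡T = e , e∈G , e∩V≡T , refl

matching-map : ∀ {n} {P Q : Subset n → Set} {m} → (∀ {f} → P f → Q f) →
  HasMatchingOfSize P m → HasMatchingOfSize Q m
matching-map P⇒Q (M , m≤∣M∣ , PM , disjM) = M , m≤∣M∣ , All.map P⇒Q PM , disjM

good-∪ : ∀ {n} m (G : Hypergraph n) (V Z : Subset n) →
  (∀ {e} → e ∈E G → Good m Z (link G V (e ∩ V))) → Good m (V ∪ Z) G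
good-∪ m G V Z good X X⊆V∪Z _ d ((_ , (e , e∈G , eY , refl , ne) , ∣f∣≡d) , maximal) =
  matching-map (λ (edge , ∣f∣≡d) → fromLink edge , ∣f∣≡d)
    (good e∈G (X ∩ Z) (p∩q⊆q X Z) (_ , toLink) d
      ((_ , toLink , ∣f∣≡d) , λ d′ (f , edge , ∣f∣≡d′) → maximal d′ (f , fromLink edge , ∣f∣≡d′)))
  where
  toLink : EdgeOf-GYX (link G V (e ∩ V)) Z (X ∩ Z) (e ─ X)
  toLink = e ─ V , link-∈⁺ V e∈G , survives-link eY , restrict-link (trace⊆ eY) X⊆V∪Z , ne
  fromLink : ∀ {f} → EdgeOf-GYX (link G V (e ∩ V)) Z (X ∩ Z) f → EdgeOf-GYX G (V ∪ Z) X f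
  fromLink (a , a∈link , aZ , refl , nf) with link-∈⁻ V (e ∩ V) a∈link
  ... | e′ , e′∈G , e′∩V≡e∩V , refl =
    e′ , e′∈G , survives-from-link T′⊆X aZ , sym (restrict-link T′⊆X X⊆V∪Z) , nf
    where
    T′⊆X : e′ ∩ V ⊆ X
    T′⊆X = subst (_⊆ X) (sym e′∩V≡e∩V) (trace⊆ eY)

subsetsOf : ∀ {n} → Subset n → List (Subset n)
subsetsOf [] = [] ∷ []
subsetsOf (false ∷ V) = map (false ∷_) (subsetsOf V)
subsetsOf (true ∷ V) = map (false ∷_) (subsetsOf V) ++ map (true ∷_) (subsetsOf V)

length-subsetsOf : ∀ {n} (V : Subset n) → length (subsetsOf V) ≡ 2 ^ ∣ V ∣
length-subsetsOf [] = refl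
length-subsetsOf (false ∷ V) = trans (length-map _ (subsetsOf V)) (length-subsetsOf V)
length-subsetsOf (true ∷ V) =
  trans (length-++ (map (false ∷_) (subsetsOf V)))
        (cong₂ _+_ half (trans half (sym (+-identityʳ _))))
  where
  half : ∀ {b} → length (map (b ∷_) (subsetsOf V)) ≡ 2 ^ ∣ V ∣
  half = trans (length-map _ (subsetsOf V)) (length-subsetsOf V)

∩∈subsetsOf : ∀ {n} (e V : Subset n) → e ∩ V ∈ₗ subsetsOf V
∩∈subsetsOf [] [] = here refl
∩∈subsetsOf (true ∷ e) (false ∷ V) = ∈-map⁺ (false ∷_) (∩∈subsetsOf e V)
∩∈subsetsOf (false ∷ e) (false ∷ V) = ∈-map⁺ (false ∷_) (∩∈subsetsOf e V)
∩∈subsetsOf (false ∷ e) (true ∷ V) = ∈-++⁺ˡ (∈-map⁺ (false ∷_) (∩∈subsetsOf e V))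
∩∈subsetsOf (true ∷ e) (true ∷ V) = ∈-++⁺ʳ (map (false ∷_) (subsetsOf V)) (∈-map⁺ (true ∷_) (∩∈subsetsOf e V))

-- The edge size ℓ − |T| of a link of an ℓ-uniform hypergraph, written so that
-- it is at most ℓ − 1 also for T = ∅ (whose link is empty when V covers G).
linkRank : ∀ {n} → ℕ → Subset n → ℕ
linkRank ℓ T = (ℓ ∸ 1) ∸ (∣ T ∣ ∸ 1)

∸≡pred∸pred : ∀ ℓ t → (0 < ℓ → 0 < t) → ℓ ∸ t ≡ (ℓ ∸ 1) ∸ (t ∸ 1)
∸≡pred∸pred zero t _ = trans (0∸n≡0 t) (sym (0∸n≡0 (t ∸ 1)))
∸≡pred∸pred (suc ℓ) zero t>0 with t>0 (s≤s z≤n)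
... | ()
∸≡pred∸pred (suc ℓ) (suc t) _ = refl

link-uniform : ∀ {n} {ℓ} {G : Hypergraph n} {V} T → Uniform ℓ G → Covers V G → Uniform (linkRank ℓ T) (link G V T)
link-uniform {ℓ = ℓ} {G} {V} T uniform covers = All.map⁺ (All.tabulate λ {e} e∈filter →
  let (e∈G , e∩V≡T) = ∈-filter⁻ (λ e′ → e′ ∩ V ≟ₛ T) e∈filter
      ∣e∣≡ℓ = All.lookup uniform e∈G
      T≢∅ : 0 < ℓ → 0 < ∣ T ∣
      T≢∅ ℓ>0 = subst (λ T → 0 < ∣ T ∣) e∩V≡T
        (nonempty⇒∣p∣>0 (covers e∈G (∣p∣>0⇒nonempty (subst (0 <_) (sym ∣e∣≡ℓ) ℓ>0))))
  in begin
    ∣ e ─ V ∣                          ≡⟨ sym (m+n∸m≡n ∣ e ∩ V ∣ ∣ e ─ V ∣) ⟩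
    ∣ e ∩ V ∣ + ∣ e ─ V ∣ ∸ ∣ e ∩ V ∣  ≡⟨ cong (_∸ ∣ e ∩ V ∣) (sym (∣p∣≡∣p∩q∣+∣p─q∣ e V)) ⟩
    ∣ e ∣ ∸ ∣ e ∩ V ∣                  ≡⟨ cong₂ _∸_ ∣e∣≡ℓ (cong ∣_∣ e∩V≡T) ⟩
    ℓ ∸ ∣ T ∣                          ≡⟨ ∸≡pred∸pred ℓ ∣ T ∣ T≢∅ ⟩
    linkRank ℓ T                       ∎)
  where open ≡-Reasoning

Family : ℕ → Set
Family n = List (ℕ × Hypergraph n)

RankAtMost : ∀ {n} → ℕ → ℕ × Hypergraph n → Set
RankAtMost u (ℓ , G) = ℓ ≤ u × Uniform ℓ G

WellRanked : ∀ {n} → ℕ → Family n → Set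
WellRanked u = All (RankAtMost u)

links : ∀ {n} → Subset n → ℕ × Hypergraph n → Family n
links V (ℓ , G) = map (λ T → linkRank ℓ T , link G V T) (subsetsOf V)

linkFamily : ∀ {n} → Subset n → Family n → Family n
linkFamily V = concatMap (links V)

length-linkFamily : ∀ {n} (V : Subset n) (F : Family n) → length (linkFamily V F) ≡ length F * 2 ^ ∣ V ∣
length-linkFamily V [] = refl
length-linkFamily V (p ∷ F) =
  trans (length-++ (links V p))
        (cong₂ _+_ (trans (length-map _ (subsetsOf V)) (length-subsetsOf V)) (length-linkFamily V F))

linkFamily-wellRanked : ∀ {n} {u} (V : Subset n) (F : Family n) → WellRanked (suc u) F →
  All (Covers V ∘ proj₂) F → WellRanked u (linkFamily V F)
linkFamily-wellRanked {u = u} V F ranked covers =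
  All.concat⁺ (All.map⁺ (All.map linksRanked (All.zip (ranked , covers))))
  where
  linksRanked : ∀ {p} → RankAtMost (suc u) p × Covers V (proj₂ p) →
    WellRanked u (links V p)
  linksRanked ((ℓ≤1+u , uniform) , coversG) = All.map⁺ (All.tabulate λ {T} _ →
    ≤-trans (m∸n≤m _ (∣ T ∣ ∸ 1)) (∸-monoˡ-≤ 1 ℓ≤1+u) , link-uniform T uniform coversG)

good-∪-linkFamily : ∀ {n} m (V Z : Subset n) (F : Family n) →
  All (Good m Z ∘ proj₂) (linkFamily V F) → All (Good m (V ∪ Z) ∘ proj₂) F
good-∪-linkFamily m V Z F goodLinks = All.map
  (λ {(ℓ , G)} goodLinksOfG → good-∪ m G V Z λ {e} _ → All.lookup (All.map⁻ goodLinksOfG) (∩∈subsetsOf e V))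
  (All.map⁻ (All.concat⁻ goodLinks))

step⇒mono : (L : ℕ → ℕ) → (∀ i → L i ≤ L (suc i)) → ∀ {i j} → i ≤ j → L i ≤ L j
step⇒mono L step {j = zero} z≤n = ≤-refl
step⇒mono L step {j = suc j} i≤1+j with m≤n⇒m<n∨m≡n i≤1+j
... | inj₁ (s≤s i≤j) = ≤-trans (step⇒mono L step i≤j) (step j)
... | inj₂ refl = ≤-refl

module _ {A : Set} (g : A → ℕ) where

  private
    above? : (L : ℕ → ℕ) (x : A) → Dec (L 1 ≤ g x)
    above? L x = L 1 ≤? g x

  missedInterval : (L : ℕ → ℕ) → (∀ i → L i ≤ L (suc i)) → ∀ k (xs : List A) → length xs ≤ k →
    ∃ λ i → i ≤ k × All (λ x → g x < L i ⊎ L (suc i) ≤ g x) xs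
  missedInterval L step zero [] _ = 0 , z≤n , []
  missedInterval L step (suc k) xs ∣xs∣≤1+k with all? (above? L) xs
  ... | yes allAbove = 0 , z≤n , All.map inj₂ allAbove
  ... | no notAllAbove with missedInterval (L ∘ suc) (step ∘ suc) k (filter (above? L) xs) shorter
    where
    shorter : length (filter (above? L) xs) ≤ k
    shorter = ≤-pred (≤-trans (filter-notAll (above? L) xs (All.¬All⇒Any¬ (above? L) xs notAllAbove)) ∣xs∣≤1+k)
  ... | i , i≤k , sep =
    suc i , s≤s i≤k , All.filter⁻ (above? L) sep (All.map below (All.all-filter (¬? ∘ above? L) xs))
    where
    below : ∀ {x} → ¬ L 1 ≤ g x → g x < L (suc i) ⊎ L (suc (suc i)) ≤ g x
    below L1≰gx = inj₁ (<-≤-trans (≰⇒> L1≰gx) (step⇒mono L step (s≤s z≤n)))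

gapBound : (ℕ → ℕ) → (s k t : ℕ) → ℕ
gapBound c s k t = k * (t * s) + c (k * 2 ^ (k * (t * s)))

-- Each threshold exceeds the previous one t by m plus the size bound for the
-- good set built when the gap lies just above t.
thresholds : (ℕ → ℕ) → (m s k : ℕ) → ℕ → ℕ
thresholds c m s k zero = 0
thresholds c m s k (suc i) = t + (m + gapBound c s k t)
  where t = thresholds c m s k i

familyBound : ℕ → ℕ → ℕ → ℕ
familyBound m zero k = 0
familyBound m (suc u) k = thresholds (familyBound m u) m (suc u) k (suc k)

C : ℕ → ℕ → ℕ
C zero m = 0
C (suc u) m = m * suc u + familyBound m u (2 ^ (m * suc u))

HasGoodSets : ℕ → ℕ → (ℕ → ℕ) → Set
HasGoodSets m u c = ∀ {n} k (F : Family n) → length F ≤ k → WellRanked u F →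
  Σ (Subset n) λ Z → ∣ Z ∣ ≤ c k × All (Good m Z ∘ proj₂) F

goodSets-0 : ∀ m → HasGoodSets m 0 (λ _ → 0)
goodSets-0 m {n} k F _ ranked = ⊥ , ≤-reflexive (∣⊥∣≡0 n) , All.map
  (λ (ℓ≤0 , uniform) → good-of-0-uniform m ⊥ (subst (λ ℓ → Uniform ℓ _) (n≤0⇒n≡0 ℓ≤0) uniform)) ranked

goodSet-via-cover : ∀ {m u c} → HasGoodSets m u c → ∀ {n} k x (F : Family n) (V : Subset n) →
  length F ≤ k → ∣ V ∣ ≤ x → WellRanked (suc u) F → All (Covers V ∘ proj₂) F →
  Σ (Subset n) λ Y → ∣ Y ∣ ≤ x + c (k * 2 ^ x) × V ⊆ Y × All (Good m Y ∘ proj₂) F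
goodSet-via-cover {m} hasGoodSets k x F V ∣F∣≤k ∣V∣≤x ranked covers
  with hasGoodSets (k * 2 ^ x) (linkFamily V F) ∣links∣≤ (linkFamily-wellRanked V F ranked covers)
  where
  ∣links∣≤ : length (linkFamily V F) ≤ k * 2 ^ x
  ∣links∣≤ = subst (_≤ k * 2 ^ x) (sym (length-linkFamily V F)) (*-mono-≤ ∣F∣≤k (^-monoʳ-≤ 2 ∣V∣≤x))
... | Z , ∣Z∣≤ , goodZ =
  V ∪ Z , ≤-trans (∣p∪q∣≤∣p∣+∣q∣ V Z) (+-mono-≤ ∣V∣≤x ∣Z∣≤) , p⊆p∪q Z , good-∪-linkFamily m V Z F goodZ

greedySize : ∀ {n} → ℕ × Hypergraph n → ℕ
greedySize (_ , G) = length (greedy G)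

goodSet-at-gap : ∀ {m u c} → HasGoodSets m u c → ∀ {n} k t t′ (F : Family n) →
  length F ≤ k → WellRanked (suc u) F → All (λ p → greedySize p < t ⊎ t′ ≤ greedySize p) F →
  m + gapBound c (suc u) k t ≤ t′ →
  Σ (Subset n) λ Y → ∣ Y ∣ ≤ gapBound c (suc u) k t × All (Good m Y ∘ proj₂) F
goodSet-at-gap {m} {u} {c} hasGoodSets {n} k t t′ F ∣F∣≤k ranked sep m+bound≤t′ =
  finish (goodSet-via-cover hasGoodSets k (k * (t * suc u)) low V ∣low∣≤k ∣V∣≤
                            (All.filter⁺ small? ranked) lowCovered)
  where
  small? : ∀ p → Dec (greedySize p < t)
  small? p = greedySize p <? t
  low : Family n
  low = filter small? F
  ∣low∣≤k : length low ≤ k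
  ∣low∣≤k = ≤-trans (length-filter small? F) ∣F∣≤k
  cover : ℕ × Hypergraph n → Subset n
  cover (_ , G) = ⋃ (greedy G)
  V : Subset n
  V = ⋃ (map cover low)
  lowCovered : All (Covers V ∘ proj₂) low
  lowCovered = All.tabulate λ {(_ , G)} p∈low → covers-⊆ (⊆⋃ (∈-map⁺ cover p∈low)) (greedy-covers G)
  ∣cover∣≤ : ∀ {p} → RankAtMost (suc u) p × greedySize p < t → ∣ cover p ∣ ≤ t * suc u
  ∣cover∣≤ {_ , G} ((ℓ≤1+u , uniform) , small) = ≤-trans (∣⋃greedy∣≤ G uniform) (*-mono-≤ (<⇒≤ small) ℓ≤1+u)
  ∣V∣≤ : ∣ V ∣ ≤ k * (t * suc u)
  ∣V∣≤ = ≤-trans (∣⋃M∣≤ (t * suc u) (map cover low)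
                   (All.map⁺ (All.map ∣cover∣≤ (All.zip (All.filter⁺ small? ranked , All.all-filter small? F)))))
                 (≤-trans (≤-reflexive (cong (_* (t * suc u)) (length-map cover low)))
                          (*-monoˡ-≤ (t * suc u) ∣low∣≤k))
  large : ∀ {Y} → ∣ Y ∣ ≤ gapBound c (suc u) k t → ∀ {p} →
    (RankAtMost (suc u) p × (greedySize p < t ⊎ t′ ≤ greedySize p)) × ¬ greedySize p < t →
    Good m Y (proj₂ p)
  large _ {_ , G} ((_ , inj₁ small) , notSmall) = ⊥-elim (notSmall small)
  large {Y} ∣Y∣≤ {_ , G} (((_ , uniform) , inj₂ t′≤) , _) =
    good-of-large-matching m Y uniform (greedy G) (greedy⊆ G) (greedy-disjoint G)
      (≤-trans (+-monoʳ-≤ m ∣Y∣≤) (≤-trans m+bound≤t′ t′≤))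
  finish : (Σ (Subset n) λ Y → ∣ Y ∣ ≤ gapBound c (suc u) k t × V ⊆ Y × All (Good m Y ∘ proj₂) low) →
    Σ (Subset n) λ Y → ∣ Y ∣ ≤ gapBound c (suc u) k t × All (Good m Y ∘ proj₂) F
  finish (Y , ∣Y∣≤ , _ , goodLow) = Y , ∣Y∣≤ , All.filter⁻ small? goodLow
    (All.map (large ∣Y∣≤) (All.zip (All.filter⁺ (¬? ∘ small?) (All.zip (ranked , sep)) ,
                                    All.all-filter (¬? ∘ small?) F)))

goodSets-suc : ∀ {m u c} → HasGoodSets m u c → HasGoodSets m (suc u) (λ k → thresholds c m (suc u) k (suc k))
goodSets-suc {m} {u} {c} hasGoodSets {n} k F ∣F∣≤k ranked = finish (missedInterval greedySize L step k F ∣F∣≤k)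
  where
  L : ℕ → ℕ
  L = thresholds c m (suc u) k
  step : ∀ i → L i ≤ L (suc i)
  step i = m≤m+n (L i) _
  finish : (∃ λ i → i ≤ k × All (λ p → greedySize p < L i ⊎ L (suc i) ≤ greedySize p) F) →
    Σ (Subset n) λ Y → ∣ Y ∣ ≤ thresholds c m (suc u) k (suc k) × All (Good m Y ∘ proj₂) F
  finish (i , i≤k , sep) =
    let (Y , ∣Y∣≤ , good) = goodSet-at-gap hasGoodSets k (L i) (L (suc i)) F ∣F∣≤k ranked sep (m≤n+m _ (L i))
    in Y , ≤-trans ∣Y∣≤ (≤-trans (≤-trans (m≤n+m _ m) (m≤n+m _ (L i))) (step⇒mono L step (s≤s i≤k))) , good

goodSets : ∀ m u → HasGoodSets m u (familyBound m u)
goodSets m zero = goodSets-0 m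
goodSets m (suc u) = goodSets-suc (goodSets m u)

goodCoveringSet : ∀ (r m n : ℕ) (G : Hypergraph n) → Uniform r G →
  Σ (Subset n) λ Y → ∣ Y ∣ ≤ C r m × Good m Y G × (Nonempty Y → ∀ (e : Subset n) → e ∈E G → Nonempty (e ∩ Y))
goodCoveringSet zero m n G uniform =
  ⊥ , ≤-reflexive (∣⊥∣≡0 n) , good-of-0-uniform m ⊥ uniform , λ (_ , x∈⊥) → ⊥-elim (∉⊥ x∈⊥)
goodCoveringSet (suc u) m n G uniform with m ≤? length (greedy G)
... | yes m≤∣M∣ =
  ⊥ , ≤-trans (≤-reflexive (∣⊥∣≡0 n)) z≤n ,
  good-of-large-matching m ⊥ uniform (greedy G) (greedy⊆ G) (greedy-disjoint G)
    (subst (_≤ length (greedy G)) (sym (trans (cong (m +_) (∣⊥∣≡0 n)) (+-identityʳ m))) m≤∣M∣) ,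
  λ (_ , x∈⊥) → ⊥-elim (∉⊥ x∈⊥)
... | no m≰∣M∣ with goodSet-via-cover (goodSets m u) 1 (m * suc u) ((suc u , G) ∷ []) (⋃ (greedy G))
                      ≤-refl ∣V∣≤ ((≤-refl , uniform) ∷ []) (greedy-covers G ∷ [])
  where
  ∣V∣≤ : ∣ ⋃ (greedy G) ∣ ≤ m * suc u
  ∣V∣≤ = ≤-trans (∣⋃greedy∣≤ G uniform) (*-monoˡ-≤ (suc u) (<⇒≤ (≰⇒> m≰∣M∣)))
... | Y , ∣Y∣≤ , V⊆Y , goodG ∷ [] =
  Y , subst (λ k → ∣ Y ∣ ≤ m * suc u + familyBound m u k) (*-identityˡ (2 ^ (m * suc u))) ∣Y∣≤ , goodG ,
  λ _ e e∈G → covers-⊆ V⊆Y (greedy-covers G) e∈G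
                (∣p∣>0⇒nonempty (subst (0 <_) (sym (All.lookup uniform e∈G)) (s≤s z≤n)))

lemma8p2 : Σ (ℕ → ℕ → ℕ) λ C →
    ∀ (r m n : ℕ) (G : Hypergraph n) → Uniform r G →
    Σ (Subset n) λ Y →
      (∣ Y ∣ ≤ C r m)
      × (∀ (X : Subset n) → X ⊆ Y → GYX-Nonempty G Y X →
           ∀ (d : ℕ) → IsMaxEdgeSize G Y X d →
           HasMatchingOfSize (EdgeOf-GYXd G Y X d) m)
      × (Nonempty Y → ∀ (e : Subset n) → e ∈E G → Nonempty (e ∩ Y))
lemma8p2 = C , goodCoveringSet
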